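{- Let $Q$ be a fork with point of return $r$. Then any full subquiver $Q'$ of $Q$ that does not have $r$ as a vertex (such a $Q'$ is necessarily connected) has a finite forkless part. Indeed, $Q'$ is mutation-equivalent to exactly $m$ distinct abundant acyclic quivers, where $m$ is the number of vertices of $Q'$.
   Context: A quiver is a finite directed multigraph with no loops and no 2-cycles; $q_{ij}$ is the number of arrows $i\to j$ if positive and minus the number of arrows $j\to i$ otherwise. Mutation $\mu_v$: $q'_{ab}=-q_{ab}$ if $v\in\{a,b\}$, else $q'_{ab}=q_{ab}+\max(q_{av},0)\max(q_{vb},0)-\max(q_{bv},0)\max(q_{va},0)$. The labelled mutation class $[Q]$ is the set of quivers on the same vertex set obtainable from $Q$ by mutations; quivers in it are counted as labelled quivers. A full subquiver is induced on a vertex subset. Abundant: at least two arrows between every pair of distinct vertices; acyclic: no directed cycle; $Q^+(v)=\{j:q_{vj}>0\}$, $Q^-(v)=\{j:q_{jv}>0\}$. A fork is an abundant, non-acyclic quiver $F$ with a vertex $r$ (point of return) such that for all $i\in F^-(r)$, $j\in F^+(r)$: $f_{ji}>f_{ir}$ and $f_{ji}>f_{rj}$, and the full subquivers on $F^-(r)$ and $F^+(r)$ are acyclic. A quiver has a finite forkless part if its labelled mutation class contains only finitely many quivers that are not forks. -}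

module Defs where

open import Data.Nat using (ℕ; zero; suc) renaming (_≤_ to _≤ℕ_)
open import Data.Integer using (ℤ; +_; -_; _+_; _-_; _*_; _⊔_; _<_; ∣_∣)
open import Data.Fin using (Fin; _≟_)
open import Data.List using (List; []; _∷_; foldl; length)
open import Data.List.Relation.Unary.Any using (Any)
open import Data.List.Relation.Unary.AllPairs using (AllPairs)
open import Data.Product using (Σ; ∃; _×_; _,_)
open import Data.Sum using (_⊎_)
open import Data.Empty using (⊥)
open import Data.Unit using (⊤)
open import Data.List.Relation.Unary.All using (All)
open import Relation.Nullary using (¬_; yes; no)
open import Relation.Binary.PropositionalEquality using (_≡_; _≢_)
open import Function.Definitions using (Injective)

-- A (labelled) quiver on vertex set Fin n, given by its exchange matrix q
-- (q i j = #arrows i→j if positive, minus #arrows j→i otherwise).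
Matrix : ℕ → Set
Matrix n = Fin n → Fin n → ℤ

-- No loops and no 2-cycles: the matrix is skew-symmetric.
IsQuiver : ∀ {n} → Matrix n → Set
IsQuiver {n} q = ∀ (i j : Fin n) → q i j ≡ - q j i

_≐_ : ∀ {n} → Matrix n → Matrix n → Set
_≐_ {n} p q = ∀ (i j : Fin n) → p i j ≡ q i j

pos : ℤ → ℤ
pos x = x ⊔ + 0

μ : ∀ {n} → Fin n → Matrix n → Matrix n
μ v q a b with a ≟ v | b ≟ v
... | yes _ | _     = - q a b
... | no _  | yes _ = - q a b
... | no _  | no _  = q a b + pos (q a v) * pos (q v b) - pos (q b v) * pos (q v a)

mutateSeq : ∀ {n} → List (Fin n) → Matrix n → Matrix n
mutateSeq vs q = foldl (λ p v → μ v p) q vs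

InClass : ∀ {n} → Matrix n → Matrix n → Set
InClass {n} q p = Σ (List (Fin n)) λ vs → mutateSeq vs q ≐ p

Abundant : ∀ {n} → Matrix n → Set
Abundant {n} q = ∀ (i j : Fin n) → i ≢ j → 2 ≤ℕ ∣ q i j ∣

data PathIn {n} (q : Matrix n) (U : Fin n → Set) : Fin n → Fin n → Set where
  edge : ∀ {a b} → U a → U b → + 0 < q a b → PathIn q U a b
  step : ∀ {a b c} → U a → + 0 < q a b → PathIn q U b c → PathIn q U a c

AcyclicOn : ∀ {n} → Matrix n → (Fin n → Set) → Set
AcyclicOn {n} q U = ∀ (a : Fin n) → ¬ PathIn q U a a

Acyclic : ∀ {n} → Matrix n → Set
Acyclic q = AcyclicOn q (λ _ → ⊤)

Out : ∀ {n} → Matrix n → Fin n → Fin n → Set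
Out q v j = + 0 < q v j

In : ∀ {n} → Matrix n → Fin n → Fin n → Set
In q v i = + 0 < q i v

IsForkAt : ∀ {n} → Matrix n → Fin n → Set
IsForkAt {n} f r =
  Abundant f × ¬ Acyclic f
  × (∀ (i j : Fin n) → In f r i → Out f r j → (f i r < f j i) × (f r j < f j i))
  × AcyclicOn f (In f r) × AcyclicOn f (Out f r)

IsFork : ∀ {n} → Matrix n → Set
IsFork {n} f = ∃ λ (r : Fin n) → IsForkAt f r

restrict : ∀ {n m} → (Fin m → Fin n) → Matrix n → Matrix m
restrict e q i j = q (e i) (e j)

FiniteForklessPart : ∀ {n} → Matrix n → Set
FiniteForklessPart {n} q =
  Σ (List (Matrix n)) λ L →
    ∀ (p : Matrix n) → InClass q p → ¬ IsFork p → Any (λ s → p ≐ s) L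

ExactlyAbundantAcyclic : ∀ {n} → Matrix n → ℕ → Set
ExactlyAbundantAcyclic {n} q k =
  Σ (List (Matrix n)) λ L →
    (length L ≡ k)
    × AllPairs (λ s t → ¬ (s ≐ t)) L
    × All (λ s → InClass q s × Abundant s × Acyclic s) L
    × (∀ (p : Matrix n) → InClass q p → Abundant p → Acyclic p → Any (λ s → p ≐ s) L)

-- Deleting the point of return r of a fork leaves an abundant acyclic quiver: the fork
-- inequalities force every arrow between In(r) and Out(r) to point into In(r), and both
-- parts are acyclic. For an abundant acyclic quiver A on k vertices, mutating successively
-- at the current source runs through a cycle rot 0, …, rot (k - 1), rot k = rot 0 of k
-- distinct abundant acyclic quivers. Mutating rot t at a vertex that is neither its source
-- nor its sink gives a fork with that vertex as point of return; mutating a fork at any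
-- other vertex v gives a fork with point of return v, since the fork inequalities make the
-- new arrows j → i outweigh the paths j → v → i; and mutating a fork at its point of return
-- undoes the step that created it. So [A] consists of the cycle and forks.

module Submission where

open import Defs
open import Data.Nat as ℕ using (ℕ; zero; suc; z≤n; s≤s)
import Data.Nat.Properties as ℕP
open import Data.Integer as ℤ using (ℤ; +_; -_; _+_; _-_; _*_; ∣_∣; +[1+_]; +<+; _<_; _≤_)
import Data.Integer.Properties as ℤP
open import Data.Integer.Tactic.RingSolver using (solve-∀)
open import Data.Fin as Fin using (Fin; _≟_)
import Data.Fin.Properties as FinP
open import Data.Fin.Subset as Subset using (Subset; _∈_)
open import Data.Fin.Subset.Properties using (p⊂q⇒∣p∣<∣q∣; ∈⊤; ∣⊤∣≡n)
open import Data.Vec as Vec using ()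
import Data.Vec.Properties as VecP
open import Data.Bool using (Bool; true; false; not; _xor_; if_then_else_)
import Data.Bool.Properties as BoolP
open import Data.List using (List; []; _∷_; _++_; tabulate)
import Data.List.Properties as List
open import Data.List.Relation.Unary.Any using (Any)
import Data.List.Relation.Unary.Any.Properties as Any
import Data.List.Relation.Unary.All.Properties as All
import Data.List.Relation.Unary.AllPairs.Properties as AllPairs
open import Data.Product using (∃; _×_; _,_; proj₁; proj₂)
open import Data.Sum using (_⊎_; inj₁; inj₂)
open import Data.Empty using (⊥; ⊥-elim)
open import Data.Unit using (⊤; tt)
open import Function using (_∘_)
open import Function.Definitions using (Injective)
open import Relation.Nullary using (¬_; yes; no; Dec; does)
open import Relation.Nullary.Decidable using (dec-true; dec-false)
open import Relation.Binary.Definitions using (tri<; tri≈; tri>)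
open import Relation.Binary.PropositionalEquality
  using (_≡_; _≢_; refl; sym; trans; cong; subst; subst₂; module ≡-Reasoning)

positive-view : ∀ {x} → + 0 < x → ∃ λ a → x ≡ +[1+ a ]
positive-view {+[1+ a ]} _ = a , refl
positive-view {+ zero} (+<+ ())

pos-positive : ∀ {x} → + 0 < x → pos x ≡ x
pos-positive h = ℤP.i≥j⇒i⊔j≡i (ℤP.<⇒≤ h)

pos-nonPositive : ∀ {x} → ¬ (+ 0 < x) → pos x ≡ + 0
pos-nonPositive h = ℤP.i≤j⇒i⊔j≡j (ℤP.≮⇒≥ h)

pos*pos≡0 : ∀ {x y} → ¬ (+ 0 < x × + 0 < y) → pos x * pos y ≡ + 0
pos*pos≡0 {x} {y} h with + 0 ℤ.<? x
... | no x≯0 rewrite pos-nonPositive x≯0 = ℤP.*-zeroˡ (pos y)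
... | yes x>0 rewrite pos-nonPositive (λ y>0 → h (x>0 , y>0)) = ℤP.*-zeroʳ (pos x)

positive-<+* : ∀ {x y z} → + 0 < x → + 0 < y → + 0 < z → (x < z + x * y) × (y < z + x * y)
positive-<+* x>0 y>0 z>0 with positive-view x>0 | positive-view y>0 | positive-view z>0
... | a , refl | b , refl | c , refl =
  +<+ (ℕP.≤-<-trans (ℕP.m≤m*n (suc a) (suc b)) (ℕP.m<n+m _ (s≤s z≤n))) ,
  +<+ (ℕP.≤-<-trans (ℕP.m≤n*m (suc b) (suc a)) (ℕP.m<n+m _ (s≤s z≤n)))

u+v<w*t : ∀ {u v w t} → u ≤ w → v < w → + 0 < w → + 2 ≤ t → u + v < w * t
u+v<w*t {u} {v} {w} {t} u≤w v<w w>0 t≥2 with positive-view w>0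
... | c , refl = ℤP.<-≤-trans (ℤP.+-mono-≤-< u≤w v<w)
                   (subst (_≤ +[1+ c ] * t) (double +[1+ c ]) (ℤP.*-monoˡ-≤-nonNeg +[1+ c ] t≥2))
  where
  double : ∀ w → w * + 2 ≡ w + w
  double = solve-∀

a+b<c⇒a<-b+c : ∀ {a b c} → a + b < c → a < - b + c
a+b<c⇒a<-b+c {a} {b} {c} h = subst₂ _<_ (cancel a b) (ℤP.+-comm c (- b)) (ℤP.+-monoˡ-< (- b) h)
  where
  cancel : ∀ a b → a + b + - b ≡ a
  cancel = solve-∀

positive⇒2≤ : ∀ {x} → + 0 < x → 2 ℕ.≤ ∣ x ∣ → + 2 ≤ x
positive⇒2≤ x>0 2≤∣x∣ with positive-view x>0
... | _ , refl = ℤ.+≤+ 2≤∣x∣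

2≤∣i∣⇒2≤∣j∣ : ∀ {i j} → + 0 < i → 2 ℕ.≤ ∣ i ∣ → i < j → 2 ℕ.≤ ∣ j ∣
2≤∣i∣⇒2≤∣j∣ i>0 2≤∣i∣ i<j with positive-view i>0 | positive-view (ℤP.<-trans i>0 i<j)
... | _ , refl | _ , refl with i<j
... | +<+ i<j' = ℕP.≤-trans 2≤∣i∣ (ℕP.<⇒≤ i<j')

≡-neg⇒≡0 : ∀ {x : ℤ} → x ≡ - x → x ≡ + 0
≡-neg⇒≡0 {+ zero} _ = refl
≡-neg⇒≡0 {+[1+ _ ]} ()
≡-neg⇒≡0 {ℤ.-[1+ _ ]} ()

module _ {n : ℕ} {q : Matrix n} (sk : IsQuiver q) where

  diagonal≡0 : ∀ a → q a a ≡ + 0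
  diagonal≡0 a = ≡-neg⇒≡0 (sk a a)

  noLoop : ∀ {a} → ¬ (+ 0 < q a a)
  noLoop {a} = ℤP.<-irrefl (sym (diagonal≡0 a))

  reverse-negative : ∀ {a b} → + 0 < q a b → q b a < + 0
  reverse-negative {a} {b} h = ℤP.neg-cancel-< (subst (+ 0 <_) (sk a b) h)

  reverse-positive : ∀ {a b} → q a b < + 0 → + 0 < q b a
  reverse-positive {a} {b} h = subst (+ 0 <_) (sym (sk b a)) (ℤP.neg-mono-< h)

  noTwoWay : ∀ {a b} → + 0 < q a b → ¬ (+ 0 < q b a)
  noTwoWay h = ℤP.<-asym (reverse-negative h)

  abundant⇒≢0 : Abundant q → ∀ {a b} → a ≢ b → q a b ≢ + 0
  abundant⇒≢0 ab {a} {b} a≢b qab≡0 with ab a b a≢b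
  ... | 2≤∣qab∣ rewrite qab≡0 with 2≤∣qab∣
  ...   | ()

  abundant⇒oriented : Abundant q → ∀ {a b} → a ≢ b → (+ 0 < q a b) ⊎ (+ 0 < q b a)
  abundant⇒oriented ab {a} {b} a≢b with ℤP.<-cmp (+ 0) (q a b)
  ... | tri< a→b _ _ = inj₁ a→b
  ... | tri≈ _ 0≡qab _ = ⊥-elim (abundant⇒≢0 ab a≢b (sym 0≡qab))
  ... | tri> _ _ qab<0 = inj₂ (reverse-positive qab<0)

module _ {n : ℕ} where

  ≐-refl : {p : Matrix n} → p ≐ p
  ≐-refl _ _ = refl

  ≐-sym : {p p' : Matrix n} → p ≐ p' → p' ≐ p
  ≐-sym e a b = sym (e a b)

  ≐-trans : {p p' p'' : Matrix n} → p ≐ p' → p' ≐ p'' → p ≐ p''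
  ≐-trans e f a b = trans (e a b) (f a b)

  μ-row : ∀ (q : Matrix n) v b → μ v q v b ≡ - q v b
  μ-row q v b with v ≟ v
  ... | yes _ = refl
  ... | no v≢v = ⊥-elim (v≢v refl)

  μ-column : ∀ (q : Matrix n) v a → μ v q a v ≡ - q a v
  μ-column q v a with a ≟ v | v ≟ v
  ... | yes _ | _ = refl
  ... | no _ | yes _ = refl
  ... | no _ | no v≢v = ⊥-elim (v≢v refl)

  μ-off : ∀ (q : Matrix n) {v a b} → a ≢ v → b ≢ v →
          μ v q a b ≡ q a b + pos (q a v) * pos (q v b) - pos (q b v) * pos (q v a)
  μ-off q {v} {a} {b} a≢v b≢v with a ≟ v | b ≟ v
  ... | yes a≡v | _ = ⊥-elim (a≢v a≡v)
  ... | no _ | yes b≡v = ⊥-elim (b≢v b≡v)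
  ... | no _ | no _ = refl

  μ-unchanged : ∀ (q : Matrix n) {v a b} → a ≢ v → b ≢ v →
                ¬ (+ 0 < q a v × + 0 < q v b) → ¬ (+ 0 < q b v × + 0 < q v a) →
                μ v q a b ≡ q a b
  μ-unchanged q {v} {a} {b} a≢v b≢v ¬a→v→b ¬b→v→a
    rewrite μ-off q a≢v b≢v | pos*pos≡0 ¬a→v→b | pos*pos≡0 ¬b→v→a =
    trans (ℤP.+-identityʳ (q a b + + 0)) (ℤP.+-identityʳ (q a b))

  μ-cong : ∀ {p p' : Matrix n} v → p ≐ p' → μ v p ≐ μ v p'
  μ-cong {p} {p'} v e a b with a ≟ v | b ≟ v
  ... | yes _ | _ = cong -_ (e a b)
  ... | no _ | yes _ = cong -_ (e a b)
  ... | no _ | no _ rewrite e a b | e a v | e v b | e b v | e v a = refl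

  μ-isQuiver : ∀ {q : Matrix n} v → IsQuiver q → IsQuiver (μ v q)
  μ-isQuiver {q} v sk a b = by-cases (a ≟ v) (b ≟ v)
    where
    shuffle : ∀ (y X Y : ℤ) → - y + X - Y ≡ - (y + Y - X)
    shuffle = solve-∀
    by-cases : Dec (a ≡ v) → Dec (b ≡ v) → μ v q a b ≡ - μ v q b a
    by-cases (yes refl) _ rewrite μ-row q a b | μ-column q a b = cong -_ (sk a b)
    by-cases (no _) (yes refl) rewrite μ-column q b a | μ-row q b a = cong -_ (sk a b)
    by-cases (no a≢v) (no b≢v) rewrite μ-off q a≢v b≢v | μ-off q b≢v a≢v | sk a b =
      shuffle (q b a) (pos (q a v) * pos (q v b)) (pos (q b v) * pos (q v a))

  μ-involutive : ∀ {q : Matrix n} v → IsQuiver q → μ v (μ v q) ≐ q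
  μ-involutive {q} v sk a b = by-cases (a ≟ v) (b ≟ v)
    where
    cancel : ∀ (x A B C D : ℤ) → (x + A * B - C * D) + D * C - B * A ≡ x
    cancel = solve-∀
    by-cases : Dec (a ≡ v) → Dec (b ≡ v) → μ v (μ v q) a b ≡ q a b
    by-cases (yes refl) _ rewrite μ-row (μ v q) a b | μ-row q a b = ℤP.neg-involutive _
    by-cases (no _) (yes refl) rewrite μ-column (μ v q) b a | μ-column q b a = ℤP.neg-involutive _
    by-cases (no a≢v) (no b≢v)
      rewrite μ-off (μ v q) a≢v b≢v | μ-column q v a | μ-row q v b | μ-column q v b | μ-row q v a
            | μ-off q a≢v b≢v | sym (sk v a) | sym (sk b v) | sym (sk v b) | sym (sk a v) =
      cancel (q a b) (pos (q a v)) (pos (q v b)) (pos (q b v)) (pos (q v a))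

  inClass-μ : ∀ {q p : Matrix n} v → InClass q p → InClass q (μ v p)
  inClass-μ {q} {p} v (vs , e) = vs ++ v ∷ [] ,
    subst (_≐ μ v p) (sym (List.foldl-++ (λ p v → μ v p) q vs (v ∷ []))) (μ-cong v e)

  inClass-resp : ∀ {q p p' : Matrix n} → p ≐ p' → InClass q p → InClass q p'
  inClass-resp e (vs , f) = vs , ≐-trans f e

module _ {n : ℕ} {q : Matrix n} {U : Fin n → Set} where

  path-head : ∀ {a c} → PathIn q U a c → U a
  path-head (edge ua _ _) = ua
  path-head (step ua _ _) = ua

  path-firstArrow : ∀ {a c} → PathIn q U a c → ∃ λ b → U b × (+ 0 < q a b)
  path-firstArrow (edge {b = b} _ ub a→b) = b , ub , a→b
  path-firstArrow (step {b = b} _ a→b p) = b , path-head p , a→b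

  path-lastArrow : ∀ {a c} → PathIn q U a c → ∃ λ b → U b × (+ 0 < q b c)
  path-lastArrow (edge {a} ua _ a→c) = a , ua , a→c
  path-lastArrow (step _ _ p) = path-lastArrow p

  potential⇒acyclicOn : (h : Fin n → ℕ) → (∀ {a b} → + 0 < q a b → h a ℕ.< h b) →
                        AcyclicOn q U
  potential⇒acyclicOn h mono a p = ℕP.<-irrefl refl (increasing p)
    where
    increasing : ∀ {a c} → PathIn q U a c → h a ℕ.< h c
    increasing (edge _ _ a→c) = mono a→c
    increasing (step _ a→b p) = ℕP.<-trans (mono a→b) (increasing p)

path-map : ∀ {n} {q q' : Matrix n} {U U' : Fin n → Set} →
           (∀ {a b} → U a → U b → + 0 < q a b → + 0 < q' a b) → (∀ {a} → U a → U' a) →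
           ∀ {a c} → PathIn q U a c → PathIn q' U' a c
path-map f g (edge ua ub a→b) = edge (g ua) (g ub) (f ua ub a→b)
path-map f g (step ua a→b p) = step (g ua) (f ua (path-head p) a→b) (path-map f g p)

acyclicOn-⊆ : ∀ {n} {q : Matrix n} {U U' : Fin n → Set} → (∀ {a} → U a → U' a) →
              AcyclicOn q U' → AcyclicOn q U
acyclicOn-⊆ U⊆U' ac a p = ac a (path-map (λ _ _ a→b → a→b) U⊆U' p)

module _ {n : ℕ} {q : Matrix n} (sk : IsQuiver q) {U : Fin n → Set} where

  acyclicOn⇒transitive : Abundant q → AcyclicOn q U → ∀ {a b c} → U a → U b → U c →
                         + 0 < q a b → + 0 < q b c → + 0 < q a c
  acyclicOn⇒transitive ab ac {a} {b} {c} ua ub uc a→b b→c with a ≟ c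
  ... | yes refl = ⊥-elim (noTwoWay sk a→b b→c)
  ... | no a≢c with abundant⇒oriented sk ab a≢c
  ...   | inj₁ a→c = a→c
  ...   | inj₂ c→a = ⊥-elim (ac a (step ua a→b (step ub b→c (edge uc ua c→a))))

  module _ {r : Fin n} where

    private
      V : Fin n → Set
      V x = x ≡ r ⊎ U x

      only : ∀ {x} → V x → x ≢ r → U x
      only (inj₁ x≡r) x≢r = ⊥-elim (x≢r x≡r)
      only (inj₂ ux) _ = ux

      RNotInterior : Set
      RNotInterior = ∀ {a c} → U a → + 0 < q a r → PathIn q V r c → ⊥

      avoid : RNotInterior → ∀ {a c} → PathIn q V a c → a ≢ r → c ≢ r → PathIn q U a c
      avoid _ (edge va vc a→c) a≢r c≢r = edge (only va a≢r) (only vc c≢r) a→c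
      avoid noPass (step {b = b} va a→b p) a≢r c≢r with b ≟ r
      ... | yes refl = ⊥-elim (noPass (only va a≢r) a→b p)
      ... | no b≢r = step (only va a≢r) a→b (avoid noPass p b≢r c≢r)

      exitSink : (∀ {x} → U x → ¬ (+ 0 < q r x)) → ∀ {c} → PathIn q V r c → ⊥
      exitSink sink p with path-firstArrow p
      ... | _ , inj₁ refl , r→r = noLoop sk r→r
      ... | _ , inj₂ ub , r→b = sink ub r→b

    acyclicOn-adjoinSink : (∀ {x} → U x → ¬ (+ 0 < q r x)) → AcyclicOn q U →
                           AcyclicOn q (λ x → x ≡ r ⊎ U x)
    acyclicOn-adjoinSink sink ac a p with a ≟ r
    ... | yes refl = exitSink sink p
    ... | no a≢r = ac a (avoid (λ _ _ → exitSink sink) p a≢r a≢r)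

    acyclicOn-adjoinSource : (∀ {x} → U x → ¬ (+ 0 < q x r)) → AcyclicOn q U →
                             AcyclicOn q (λ x → x ≡ r ⊎ U x)
    acyclicOn-adjoinSource source ac a p with a ≟ r
    ... | yes refl with path-lastArrow p
    ...   | _ , inj₁ refl , r→r = noLoop sk r→r
    ...   | _ , inj₂ ub , b→r = source ub b→r
    acyclicOn-adjoinSource source ac a p | no a≢r =
      ac a (avoid (λ ua a→r _ → source ua a→r) p a≢r a≢r)

-- Mutating at a vertex that is neither a source nor a sink

-- By μ-In-Out, these say that the arrow j → i created by mutating at v outweighs both arrows
-- of the path j → v → i.
NewArrowsDominate : ∀ {n} → Matrix n → Fin n → Set
NewArrowsDominate {n} q v = ∀ (j i : Fin n) → In q v j → Out q v i →
  (q j v < q j i + q j v * q v i) × (q v i < q j i + q j v * q v i)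

module _ {n : ℕ} {q : Matrix n} (sk : IsQuiver q) {v : Fin n} where

  In⇒≢ : ∀ {x} → In q v x → x ≢ v
  In⇒≢ h refl = noLoop sk h

  Out⇒≢ : ∀ {x} → Out q v x → x ≢ v
  Out⇒≢ h refl = noLoop sk h

  μ-into : ∀ x → μ v q x v ≡ q v x
  μ-into x = trans (μ-column q v x) (sym (sk v x))

  μ-outOf : ∀ x → μ v q v x ≡ q x v
  μ-outOf x = trans (μ-row q v x) (sym (sk x v))

  μ-In⁻ : ∀ {x} → In (μ v q) v x → Out q v x
  μ-In⁻ {x} = subst (+ 0 <_) (μ-into x)

  μ-In⁺ : ∀ {x} → Out q v x → In (μ v q) v x
  μ-In⁺ {x} = subst (+ 0 <_) (sym (μ-into x))

  μ-Out⁻ : ∀ {x} → Out (μ v q) v x → In q v x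
  μ-Out⁻ {x} = subst (+ 0 <_) (μ-outOf x)

  μ-Out⁺ : ∀ {x} → In q v x → Out (μ v q) v x
  μ-Out⁺ {x} = subst (+ 0 <_) (sym (μ-outOf x))

  μ-In-In : ∀ {a b} → In q v a → In q v b → μ v q a b ≡ q a b
  μ-In-In ha hb = μ-unchanged q (In⇒≢ ha) (In⇒≢ hb)
    (λ (_ , v→b) → noTwoWay sk hb v→b) (λ (_ , v→a) → noTwoWay sk ha v→a)

  μ-Out-Out : ∀ {a b} → Out q v a → Out q v b → μ v q a b ≡ q a b
  μ-Out-Out ha hb = μ-unchanged q (Out⇒≢ ha) (Out⇒≢ hb)
    (λ (a→v , _) → noTwoWay sk ha a→v) (λ (b→v , _) → noTwoWay sk hb b→v)

  μ-In-Out : ∀ {a b} → In q v a → Out q v b → μ v q a b ≡ q a b + q a v * q v b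
  μ-In-Out {a} {b} ha hb
    rewrite μ-off q (In⇒≢ ha) (Out⇒≢ hb) | pos-positive ha | pos-positive hb
          | pos*pos≡0 {q b v} {q v a} (λ (b→v , _) → noTwoWay sk hb b→v) =
    ℤP.+-identityʳ (q a b + q a v * q v b)

  module _ (ab : Abundant q) (dominate : NewArrowsDominate q v) where

    μ-abundant : Abundant (μ v q)
    μ-abundant a b a≢b = by-cases (a ≟ v) (b ≟ v)
      where
      by-cases : Dec (a ≡ v) → Dec (b ≡ v) → 2 ℕ.≤ ∣ μ v q a b ∣
      by-cases (yes refl) _ rewrite μ-row q a b | ℤP.∣-i∣≡∣i∣ (q a b) = ab a b a≢b
      by-cases (no _) (yes refl) rewrite μ-column q b a | ℤP.∣-i∣≡∣i∣ (q a b) = ab a b a≢b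
      by-cases (no a≢v) (no b≢v) with abundant⇒oriented sk ab a≢v | abundant⇒oriented sk ab b≢v
      ... | inj₁ a→v | inj₁ b→v rewrite μ-In-In a→v b→v = ab a b a≢b
      ... | inj₂ v→a | inj₂ v→b rewrite μ-Out-Out v→a v→b = ab a b a≢b
      ... | inj₁ a→v | inj₂ v→b rewrite μ-In-Out a→v v→b =
        2≤∣i∣⇒2≤∣j∣ a→v (ab a v a≢v) (proj₁ (dominate a b a→v v→b))
      ... | inj₂ v→a | inj₁ b→v
        rewrite μ-isQuiver v sk a b | ℤP.∣-i∣≡∣i∣ (μ v q b a) | μ-In-Out b→v v→a =
        2≤∣i∣⇒2≤∣j∣ b→v (ab b v b≢v) (proj₁ (dominate b a b→v v→a))

    μ-forkInequalities : ∀ (i j : Fin n) → In (μ v q) v i → Out (μ v q) v j →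
                         (μ v q i v < μ v q j i) × (μ v q v j < μ v q j i)
    μ-forkInequalities i j hi hj =
      subst₂ _<_ (sym (μ-into i)) new (proj₂ d) , subst₂ _<_ (sym (μ-outOf j)) new (proj₁ d)
      where
      d : (q j v < q j i + q j v * q v i) × (q v i < q j i + q j v * q v i)
      d = dominate j i (μ-Out⁻ hj) (μ-In⁻ hi)
      new : q j i + q j v * q v i ≡ μ v q j i
      new = sym (μ-In-Out (μ-Out⁻ hj) (μ-In⁻ hi))

    μ-notAcyclic : ∃ (In q v) → ∃ (Out q v) → ¬ Acyclic (μ v q)
    μ-notAcyclic (j , j→v) (i , v→i) ac =
      ac v (step tt (μ-Out⁺ j→v) (step tt j→i (edge tt tt (μ-In⁺ v→i))))
      where
      j→i : + 0 < μ v q j i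
      j→i rewrite μ-In-Out j→v v→i = ℤP.<-trans j→v (proj₁ (dominate j i j→v v→i))

    μ-acyclicIn : AcyclicOn q (Out q v) → AcyclicOn (μ v q) (In (μ v q) v)
    μ-acyclicIn ac a p = ac a (path-map unchanged μ-In⁻ p)
      where
      unchanged : ∀ {a b} → In (μ v q) v a → In (μ v q) v b → + 0 < μ v q a b → + 0 < q a b
      unchanged ha hb = subst (+ 0 <_) (μ-Out-Out (μ-In⁻ ha) (μ-In⁻ hb))

    μ-acyclicOut : AcyclicOn q (In q v) → AcyclicOn (μ v q) (Out (μ v q) v)
    μ-acyclicOut ac a p = ac a (path-map unchanged μ-Out⁻ p)
      where
      unchanged : ∀ {a b} → Out (μ v q) v a → Out (μ v q) v b → + 0 < μ v q a b → + 0 < q a b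
      unchanged ha hb = subst (+ 0 <_) (μ-In-In (μ-Out⁻ ha) (μ-Out⁻ hb))

    μ-isForkAt : AcyclicOn q (In q v) → AcyclicOn q (Out q v) → ∃ (In q v) → ∃ (Out q v) →
                 IsForkAt (μ v q) v
    μ-isForkAt acIn acOut hasIn hasOut =
      μ-abundant , μ-notAcyclic hasIn hasOut , μ-forkInequalities ,
      μ-acyclicIn acOut , μ-acyclicOut acIn

μ-acyclic-isForkAt : ∀ {n} {q : Matrix n} → IsQuiver q → Abundant q → Acyclic q →
                     ∀ {v} → ∃ (In q v) → ∃ (Out q v) → IsForkAt (μ v q) v
μ-acyclic-isForkAt sk ab ac hasIn hasOut =
  μ-isForkAt sk ab
    (λ j i j→v v→i → positive-<+* j→v v→i (acyclicOn⇒transitive sk ab ac tt tt tt j→v v→i))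
    (acyclicOn-⊆ (λ _ → tt) ac) (acyclicOn-⊆ (λ _ → tt) ac) hasIn hasOut

-- Forks

module Fork {n : ℕ} {f : Matrix n} (sk : IsQuiver f) {r : Fin n} (fk : IsForkAt f r) where

  abundant : Abundant f
  abundant = proj₁ fk

  inequalities : ∀ (i j : Fin n) → In f r i → Out f r j → (f i r < f j i) × (f r j < f j i)
  inequalities = proj₁ (proj₂ (proj₂ fk))

  acyclicIn : AcyclicOn f (In f r)
  acyclicIn = proj₁ (proj₂ (proj₂ (proj₂ fk)))

  acyclicOut : AcyclicOn f (Out f r)
  acyclicOut = proj₂ (proj₂ (proj₂ (proj₂ fk)))

  side : ∀ {x} → x ≢ r → In f r x ⊎ Out f r x
  side = abundant⇒oriented sk abundant

  Out→In : ∀ {i j} → In f r i → Out f r j → + 0 < f j i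
  Out→In {i} {j} i→r r→j = ℤP.<-trans i→r (proj₁ (inequalities i j i→r r→j))

  path-In : ∀ {a c} → PathIn f (_≢ r) a c → In f r a → PathIn f (In f r) a c
  path-In (edge _ c≢r a→c) a→r with side c≢r
  ... | inj₁ c→r = edge a→r c→r a→c
  ... | inj₂ r→c = ⊥-elim (noTwoWay sk a→c (Out→In a→r r→c))
  path-In (step _ a→b p) a→r with side (path-head p)
  ... | inj₁ b→r = step a→r a→b (path-In p b→r)
  ... | inj₂ r→b = ⊥-elim (noTwoWay sk a→b (Out→In a→r r→b))

  path-Out : ∀ {a c} → PathIn f (_≢ r) a c → Out f r c → PathIn f (Out f r) a c
  path-Out (edge a≢r _ a→c) r→c with side a≢r
  ... | inj₂ r→a = edge r→a r→c a→c
  ... | inj₁ a→r = ⊥-elim (noTwoWay sk a→c (Out→In a→r r→c))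
  path-Out (step a≢r a→b p) r→c with path-Out p r→c
  ... | p' with side a≢r
  ...   | inj₂ r→a = step r→a a→b p'
  ...   | inj₁ a→r = ⊥-elim (noTwoWay sk a→b (Out→In a→r (path-head p')))

  acyclicOff : AcyclicOn f (_≢ r)
  acyclicOff a p with side (path-head p)
  ... | inj₁ a→r = acyclicIn a (path-In p a→r)
  ... | inj₂ r→a = acyclicOut a (path-Out p r→a)

  private
    r-or-off : ∀ {x} → ⊤ → x ≡ r ⊎ x ≢ r
    r-or-off {x} _ with x ≟ r
    ... | yes x≡r = inj₁ x≡r
    ... | no x≢r = inj₂ x≢r

  -- Every cycle passes through r, since f is acyclic off r.
  hasOut : ∃ (Out f r)
  hasOut with FinP.any? (λ x → + 0 ℤ.<? f r x)
  ... | yes r→x = r→x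
  ... | no noOut = ⊥-elim (proj₁ (proj₂ fk) (acyclicOn-⊆ r-or-off
          (acyclicOn-adjoinSink sk (λ {x} _ r→x → noOut (x , r→x)) acyclicOff)))

  hasIn : ∃ (In f r)
  hasIn with FinP.any? (λ x → + 0 ℤ.<? f x r)
  ... | yes x→r = x→r
  ... | no noIn = ⊥-elim (proj₁ (proj₂ fk) (acyclicOn-⊆ r-or-off
          (acyclicOn-adjoinSource sk (λ {x} _ x→r → noIn (x , x→r)) acyclicOff)))

  transitiveOff : ∀ {a b c} → a ≢ r → b ≢ r → c ≢ r → + 0 < f a b → + 0 < f b c → + 0 < f a c
  transitiveOff = acyclicOn⇒transitive sk abundant acyclicOff

  -- The two triangles through r that are oriented cycles: there the fork inequalities
  -- and abundance (f v r ≥ 2, resp. f r v ≥ 2) make the product term win.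
  dominate-into-r : ∀ {v j} → In f r v → Out f r j → + 0 < f j v →
                    (f j v < f j r + f j v * f v r) × (f v r < f j r + f j v * f v r)
  dominate-into-r {v} {j} v→r r→j j→v =
    subst (λ x → (f j v < x + f j v * f v r) × (f v r < x + f j v * f v r)) (sym (sk j r))
      ( a+b<c⇒a<-b+c (u+v<w*t ℤP.≤-refl (proj₂ ineq) j→v 2≤f-v-r)
      , a+b<c⇒a<-b+c (u+v<w*t (ℤP.<⇒≤ (proj₁ ineq)) (proj₂ ineq) j→v 2≤f-v-r))
    where
    ineq : (f v r < f j v) × (f r j < f j v)
    ineq = inequalities v j v→r r→j
    2≤f-v-r : + 2 ≤ f v r
    2≤f-v-r = positive⇒2≤ v→r (abundant v r (In⇒≢ sk v→r))

  dominate-from-r : ∀ {v i} → Out f r v → In f r i → + 0 < f v i →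
                    (f r v < f r i + f r v * f v i) × (f v i < f r i + f r v * f v i)
  dominate-from-r {v} {i} r→v i→r v→i =
    subst (λ x → (f r v < x + f r v * f v i) × (f v i < x + f r v * f v i)) (sym (sk r i))
      (subst (λ y → (f r v < - f i r + y) × (f v i < - f i r + y)) (ℤP.*-comm (f v i) (f r v))
        ( a+b<c⇒a<-b+c (u+v<w*t (ℤP.<⇒≤ (proj₂ ineq)) (proj₁ ineq) v→i 2≤f-r-v)
        , a+b<c⇒a<-b+c (u+v<w*t ℤP.≤-refl (proj₁ ineq) v→i 2≤f-r-v)))
    where
    ineq : (f i r < f v i) × (f r v < f v i)
    ineq = inequalities i v i→r r→v
    2≤f-r-v : + 2 ≤ f r v
    2≤f-r-v = positive⇒2≤ r→v (abundant r v (Out⇒≢ sk r→v ∘ sym))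

  dominate : ∀ {v} → v ≢ r → NewArrowsDominate f v
  dominate {v} v≢r j i j→v v→i with j ≟ r | i ≟ r
  ... | yes refl | yes refl = ⊥-elim (noTwoWay sk j→v v→i)
  ... | no j≢r | no i≢r = positive-<+* j→v v→i (transitiveOff j≢r v≢r i≢r j→v v→i)
  ... | no j≢r | yes refl with side j≢r
  ...   | inj₁ j→r = positive-<+* j→v v→i j→r
  ...   | inj₂ r→j = dominate-into-r v→i r→j j→v
  dominate {v} v≢r j i j→v v→i | yes refl | no i≢r with side i≢r
  ...   | inj₂ r→i = positive-<+* j→v v→i r→i
  ...   | inj₁ i→r = dominate-from-r j→v i→r v→i

  μ-isForkAt-off : ∀ {v} → v ≢ r → IsForkAt (μ v f) v
  μ-isForkAt-off {v} v≢r with side v≢r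
  ... | inj₁ v→r =
    μ-isForkAt sk abundant (dominate v≢r)
      (acyclicOn-⊆ (λ x→v x≡r → noTwoWay sk v→r (subst (λ x → + 0 < f x v) x≡r x→v)) acyclicOff)
      (acyclicOn-⊆ Out⊆ (acyclicOn-adjoinSink sk (λ x→r r→x → noTwoWay sk r→x x→r) acyclicIn))
      (proj₁ hasOut , Out→In v→r (proj₂ hasOut))
      (r , v→r)
    where
    Out⊆ : ∀ {x} → Out f v x → x ≡ r ⊎ In f r x
    Out⊆ {x} v→x with x ≟ r
    ... | yes x≡r = inj₁ x≡r
    ... | no x≢r with side x≢r
    ...   | inj₁ x→r = inj₂ x→r
    ...   | inj₂ r→x = ⊥-elim (noTwoWay sk v→x (Out→In v→r r→x))
  ... | inj₂ r→v =
    μ-isForkAt sk abundant (dominate v≢r)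
      (acyclicOn-⊆ In⊆ (acyclicOn-adjoinSource sk (λ r→x x→r → noTwoWay sk r→x x→r) acyclicOut))
      (acyclicOn-⊆ (λ v→x x≡r → noTwoWay sk r→v (subst (λ x → + 0 < f v x) x≡r v→x)) acyclicOff)
      (r , r→v)
      (proj₁ hasIn , Out→In (proj₂ hasIn) r→v)
    where
    In⊆ : ∀ {x} → In f v x → x ≡ r ⊎ Out f r x
    In⊆ {x} x→v with x ≟ r
    ... | yes x≡r = inj₁ x≡r
    ... | no x≢r with side x≢r
    ...   | inj₂ r→x = inj₂ r→x
    ...   | inj₁ x→r = ⊥-elim (noTwoWay sk x→v (Out→In x→r r→v))

-- Abundant acyclic quivers

Fin-injective⇒onto : ∀ {k} {g : Fin k → Fin k} → Injective _≡_ _≡_ g → ∀ t → ∃ λ a → g a ≡ t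
Fin-injective⇒onto {suc m} {g} inj t with FinP.any? (λ a → g a ≟ t)
... | yes hit = hit
... | no miss = ⊥-elim (collision (FinP.pigeonhole (ℕP.n<1+n m) (λ a → Fin.punchOut (avoids a))))
  where
  avoids : ∀ a → t ≢ g a
  avoids a t≡ga = miss (a , sym t≡ga)
  collision : ¬ (∃ λ i → ∃ λ j → i Fin.< j × Fin.punchOut (avoids i) ≡ Fin.punchOut (avoids j))
  collision (i , j , i<j , same) =
    FinP.<⇒≢ i<j (inj (FinP.punchOut-injective (avoids i) (avoids j) same))

module Ranks {k : ℕ} {A : Matrix k} (sk : IsQuiver A) (ab : Abundant A) (ac : Acyclic A) where

  predecessors : Fin k → Subset k
  predecessors a = Vec.tabulate (λ b → does (+ 0 ℤ.<? A b a))

  ∈-predecessors⁺ : ∀ {a b} → + 0 < A b a → b ∈ predecessors a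
  ∈-predecessors⁺ {a} {b} b→a =
    VecP.lookup⇒[]= b _ (trans (VecP.lookup∘tabulate _ b) (dec-true (+ 0 ℤ.<? A b a) b→a))

  ∈-predecessors⁻ : ∀ {a b} → b ∈ predecessors a → + 0 < A b a
  ∈-predecessors⁻ {a} {b} b∈
    with + 0 ℤ.<? A b a | trans (sym (VecP.[]=⇒lookup b∈)) (VecP.lookup∘tabulate _ b)
  ... | yes b→a | _ = b→a
  ... | no _ | ()

  rank : Fin k → ℕ
  rank a = Subset.∣ predecessors a ∣

  rank-mono : ∀ {a b} → + 0 < A a b → rank a ℕ.< rank b
  rank-mono {a} {b} a→b = p⊂q⇒∣p∣<∣q∣
    ( (λ x∈ → ∈-predecessors⁺ (acyclicOn⇒transitive sk ab ac tt tt tt (∈-predecessors⁻ x∈) a→b))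
    , a , ∈-predecessors⁺ a→b , noLoop sk ∘ ∈-predecessors⁻ )

  rank<k : ∀ a → rank a ℕ.< k
  rank<k a = subst (rank a ℕ.<_) (∣⊤∣≡n k)
    (p⊂q⇒∣p∣<∣q∣ ((λ _ → ∈⊤) , a , ∈⊤ , noLoop sk ∘ ∈-predecessors⁻))

  rank-injective : ∀ {a b} → rank a ≡ rank b → a ≡ b
  rank-injective {a} {b} same with a ≟ b
  ... | yes a≡b = a≡b
  ... | no a≢b with abundant⇒oriented sk ab a≢b
  ...   | inj₁ a→b = ⊥-elim (ℕP.<-irrefl same (rank-mono a→b))
  ...   | inj₂ b→a = ⊥-elim (ℕP.<-irrefl (sym same) (rank-mono b→a))

  private
    rankFin : Fin k → Fin k
    rankFin a = Fin.fromℕ< (rank<k a)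

    rankFin-injective : Injective _≡_ _≡_ rankFin
    rankFin-injective {a} {b} same = rank-injective
      (trans (sym (FinP.toℕ-fromℕ< (rank<k a))) (trans (cong Fin.toℕ same) (FinP.toℕ-fromℕ< (rank<k b))))

  opaque
    vertexOfRank : ∀ t → t ℕ.< k → Fin k
    vertexOfRank t t<k = proj₁ (Fin-injective⇒onto rankFin-injective (Fin.fromℕ< t<k))

    rank-vertexOfRank : ∀ t (t<k : t ℕ.< k) → rank (vertexOfRank t t<k) ≡ t
    rank-vertexOfRank t t<k = begin
      rank v                    ≡⟨ FinP.toℕ-fromℕ< (rank<k v) ⟨
      Fin.toℕ (rankFin v)       ≡⟨ cong Fin.toℕ (proj₂ (Fin-injective⇒onto rankFin-injective (Fin.fromℕ< t<k))) ⟩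
      Fin.toℕ (Fin.fromℕ< t<k)  ≡⟨ FinP.toℕ-fromℕ< t<k ⟩
      t                         ∎
      where
      open ≡-Reasoning
      v : Fin k
      v = vertexOfRank t t<k

-- The sink–source cycle

negateIf : Bool → ℤ → ℤ
negateIf true x = - x
negateIf false x = x

negateIf-neg : ∀ c x → negateIf c (- x) ≡ - negateIf c x
negateIf-neg true x = refl
negateIf-neg false x = refl

neg-negateIf : ∀ c x → - negateIf c x ≡ negateIf (not c) x
neg-negateIf true x = ℤP.neg-involutive x
neg-negateIf false x = refl

∣negateIf∣ : ∀ c x → ∣ negateIf c x ∣ ≡ ∣ x ∣
∣negateIf∣ true x = ℤP.∣-i∣≡∣i∣ x
∣negateIf∣ false x = refl

module Rotations {m : ℕ} {A : Matrix (suc m)} (sk : IsQuiver A) (ab : Abundant A) (ac : Acyclic A) where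

  open Ranks sk ab ac public

  k : ℕ
  k = suc m

  mutated : ℕ → Fin k → Bool
  mutated t a = does (rank a ℕ.<? t)

  -- A mutated successively at its vertices of rank 0, 1, …, t - 1, each a source when it is
  -- mutated: exactly the arrows between mutated and unmutated vertices are reversed.
  rot : ℕ → Matrix k
  rot t a b = negateIf (mutated t a xor mutated t b) (A a b)

  -- A topological order of rot t: the unmutated vertices by rank, then the mutated ones.
  height : ℕ → Fin k → ℕ
  height t a = if mutated t a then rank a ℕ.+ k else rank a

  mutated-true : ∀ {t a} → rank a ℕ.< t → mutated t a ≡ true
  mutated-true {t} {a} = dec-true (rank a ℕ.<? t)

  mutated-false : ∀ {t a} → t ℕ.≤ rank a → mutated t a ≡ false
  mutated-false {t} {a} t≤ = dec-false (rank a ℕ.<? t) (ℕP.≤⇒≯ t≤)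

  mutated-cases : ∀ t a → (mutated t a ≡ true × rank a ℕ.< t) ⊎ (mutated t a ≡ false × t ℕ.≤ rank a)
  mutated-cases t a with rank a ℕ.<? t
  ... | yes a<t = inj₁ (mutated-true a<t , a<t)
  ... | no a≮t = inj₂ (mutated-false (ℕP.≮⇒≥ a≮t) , ℕP.≮⇒≥ a≮t)

  mutated-suc : ∀ {t a} → rank a ≢ t → mutated (suc t) a ≡ mutated t a
  mutated-suc {t} {a} a≢t with mutated-cases t a
  ... | inj₁ (eq , a<t) rewrite eq = mutated-true (ℕP.m<n⇒m<1+n a<t)
  ... | inj₂ (eq , t≤a) rewrite eq = mutated-false (ℕP.≤∧≢⇒< t≤a (a≢t ∘ sym))

  mutated-0 : ∀ a → mutated 0 a ≡ false
  mutated-0 a = mutated-false {a = a} z≤n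

  mutated-k : ∀ a → mutated k a ≡ true
  mutated-k a = mutated-true (rank<k a)

  rot-isQuiver : ∀ t → IsQuiver (rot t)
  rot-isQuiver t a b rewrite sk a b | BoolP.xor-comm (mutated t a) (mutated t b) =
    negateIf-neg (mutated t b xor mutated t a) (A b a)

  rot-abundant : ∀ t → Abundant (rot t)
  rot-abundant t a b a≢b rewrite ∣negateIf∣ (mutated t a xor mutated t b) (A a b) = ab a b a≢b

  private
    neg≡reverse : ∀ a b → - A a b ≡ A b a
    neg≡reverse a b = trans (cong -_ (sk a b)) (ℤP.neg-involutive (A b a))

  rot-arrow⇒height : ∀ t {a b} → + 0 < rot t a b → height t a ℕ.< height t b
  rot-arrow⇒height t {a} {b} a→b with mutated-cases t a | mutated-cases t b
  ... | inj₁ (ea , _) | inj₁ (eb , _) rewrite ea | eb = ℕP.+-monoˡ-< k (rank-mono a→b)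
  ... | inj₂ (ea , _) | inj₂ (eb , _) rewrite ea | eb = rank-mono a→b
  ... | inj₂ (ea , _) | inj₁ (eb , _) rewrite ea | eb = ℕP.<-≤-trans (rank<k a) (ℕP.m≤n+m k (rank b))
  ... | inj₁ (ea , a<t) | inj₂ (eb , t≤b) rewrite ea | eb =
    ⊥-elim (ℕP.<-asym (rank-mono (subst (+ 0 <_) (neg≡reverse a b) a→b)) (ℕP.<-≤-trans a<t t≤b))

  rot-acyclic : ∀ t → Acyclic (rot t)
  rot-acyclic t = potential⇒acyclicOn (height t) (rot-arrow⇒height t)

  A≐rot-0 : A ≐ rot 0
  A≐rot-0 a b rewrite mutated-0 a | mutated-0 b = refl

  rot-k≐rot-0 : rot k ≐ rot 0
  rot-k≐rot-0 a b rewrite mutated-k a | mutated-k b | mutated-0 a | mutated-0 b = refl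

  module Source (t : ℕ) (t<k : t ℕ.< k) where

    source : Fin k
    source = vertexOfRank t t<k

    rank-source : rank source ≡ t
    rank-source = rank-vertexOfRank t t<k

    mutated-source : mutated t source ≡ false
    mutated-source = mutated-false (ℕP.≤-reflexive (sym rank-source))

    mutated-suc-source : mutated (suc t) source ≡ true
    mutated-suc-source = mutated-true (ℕP.≤-reflexive (cong suc rank-source))

    mutated-suc-other : ∀ {a} → a ≢ source → mutated (suc t) a ≡ mutated t a
    mutated-suc-other {a} a≢s = mutated-suc (λ ra≡t → a≢s (rank-injective (trans ra≡t (sym rank-source))))

    height-source : height t source ≡ t
    height-source rewrite mutated-source = rank-source

    t≤height : ∀ a → t ℕ.≤ height t a
    t≤height a with mutated-cases t a
    ... | inj₁ (e , _) rewrite e = ℕP.≤-trans (ℕP.<⇒≤ t<k) (ℕP.m≤n+m k (rank a))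
    ... | inj₂ (e , t≤a) rewrite e = t≤a

    isSource : ∀ a → ¬ (+ 0 < rot t a source)
    isSource a a→s = ℕP.<-irrefl refl
      (ℕP.<-≤-trans (subst (height t a ℕ.<_) height-source (rot-arrow⇒height t a→s)) (t≤height a))

    μ-source : μ source (rot t) ≐ rot (suc t)
    μ-source a b = by-cases (a ≟ source) (b ≟ source)
      where
      by-cases : Dec (a ≡ source) → Dec (b ≡ source) → μ source (rot t) a b ≡ rot (suc t) a b
      by-cases (yes refl) (yes refl)
        rewrite μ-row (rot t) a a | mutated-source | mutated-suc-source | diagonal≡0 sk a = refl
      by-cases (yes refl) (no b≢s)
        rewrite μ-row (rot t) a b | mutated-source | mutated-suc-source | mutated-suc-other b≢s =
        neg-negateIf (mutated t b) (A a b)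
      by-cases (no a≢s) (yes refl)
        rewrite μ-column (rot t) b a | mutated-source | mutated-suc-source | mutated-suc-other a≢s
              | BoolP.xor-identityʳ (mutated t a) | BoolP.xor-comm (mutated t a) true =
        neg-negateIf (mutated t a) (A a b)
      by-cases (no a≢s) (no b≢s)
        rewrite μ-unchanged (rot t) a≢s b≢s (isSource a ∘ proj₁) (isSource b ∘ proj₁)
              | mutated-suc-other a≢s | mutated-suc-other b≢s = refl

-- The mutation class of an abundant acyclic quiver

module _ {n : ℕ} {p p' : Matrix n} (e : p ≐ p') where

  private
    arrow : ∀ {a b} → + 0 < p a b → + 0 < p' a b
    arrow {a} {b} = subst (+ 0 <_) (e a b)

    arrow⁻ : ∀ {a b} → + 0 < p' a b → + 0 < p a b
    arrow⁻ {a} {b} = subst (+ 0 <_) (sym (e a b))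

  isQuiver-resp : IsQuiver p → IsQuiver p'
  isQuiver-resp sk a b rewrite sym (e a b) | sym (e b a) = sk a b

  abundant-resp : Abundant p → Abundant p'
  abundant-resp ab a b a≢b rewrite sym (e a b) = ab a b a≢b

  isForkAt-resp : ∀ {v} → IsForkAt p v → IsForkAt p' v
  isForkAt-resp {v} (ab , cyclic , ineq , acIn , acOut) =
    abundant-resp ab ,
    (λ ac' → cyclic (λ a path → ac' a (path-map (λ _ _ → arrow) (λ u → u) path))) ,
    (λ i j i→v v→j → let (in< , out<) = ineq i j (arrow⁻ i→v) (arrow⁻ v→j) in
       subst₂ _<_ (e i v) (e j i) in< , subst₂ _<_ (e v j) (e j i) out<) ,
    (λ a path → acIn a (path-map (λ _ _ → arrow⁻) arrow⁻ path)) ,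
    (λ a path → acOut a (path-map (λ _ _ → arrow⁻) arrow⁻ path))

module MutationClass {m : ℕ} {A : Matrix (suc m)} (sk : IsQuiver A) (ab : Abundant A) (ac : Acyclic A) where

  open Rotations sk ab ac
  open Source using (source; rank-source; isSource; μ-source)

  prev : ℕ → ℕ
  prev zero = m
  prev (suc t) = t

  prev<k : ∀ {t} → t ℕ.< k → prev t ℕ.< k
  prev<k {zero} _ = ℕP.n<1+n m
  prev<k {suc t} t<k = ℕP.<-trans (ℕP.n<1+n t) t<k

  rot-suc-prev : ∀ t → rot (suc (prev t)) ≐ rot t
  rot-suc-prev zero = rot-k≐rot-0
  rot-suc-prev (suc t) = ≐-refl

  sink : ∀ t → t ℕ.< k → Fin k
  sink t t<k = source (prev t) (prev<k t<k)

  μ-sink : ∀ t (t<k : t ℕ.< k) → μ (sink t t<k) (rot t) ≐ rot (prev t)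
  μ-sink t t<k = ≐-trans (μ-cong (sink t t<k) (≐-sym (≐-trans (μ-source (prev t) (prev<k t<k)) (rot-suc-prev t))))
                         (μ-involutive (sink t t<k) (rot-isQuiver (prev t)))

  isSink : ∀ t (t<k : t ℕ.< k) a → ¬ (+ 0 < rot t (sink t t<k) a)
  isSink t t<k a s→a = isSource (prev t) (prev<k t<k) a (subst (+ 0 <_) reversed s→a)
    where
    s : Fin k
    s = sink t t<k
    open ≡-Reasoning
    reversed : rot t s a ≡ rot (prev t) a s
    reversed = begin
      rot t s a                  ≡⟨ rot-suc-prev t s a ⟨
      rot (suc (prev t)) s a     ≡⟨ μ-source (prev t) (prev<k t<k) s a ⟨
      μ s (rot (prev t)) s a     ≡⟨ μ-row (rot (prev t)) s a ⟩
      - rot (prev t) s a         ≡⟨ rot-isQuiver (prev t) a s ⟨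
      rot (prev t) a s           ∎

  InOrbit : Matrix k → Set
  InOrbit p = ∃ λ t → t ℕ.< k × p ≐ rot t

  data ForkChain : Matrix k → Fin k → Set where
    start : ∀ {p} t v → t ℕ.< k → ∃ (In (rot t) v) → ∃ (Out (rot t) v) →
            μ v (rot t) ≐ p → ForkChain p v
    extend : ∀ {p p'} u v → ForkChain p u → v ≢ u → μ v p ≐ p' → ForkChain p' v

  chain-resp : ∀ {p p' v} → ForkChain p v → p ≐ p' → ForkChain p' v
  chain-resp (start t v t<k hasIn hasOut e) e' = start t v t<k hasIn hasOut (≐-trans e e')
  chain-resp (extend u v chain v≢u e) e' = extend u v chain v≢u (≐-trans e e')

  chain-isQuiver : ∀ {p v} → ForkChain p v → IsQuiver p
  chain-isQuiver (start t v _ _ _ e) = isQuiver-resp e (μ-isQuiver v (rot-isQuiver t))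
  chain-isQuiver (extend u v chain _ e) = isQuiver-resp e (μ-isQuiver v (chain-isQuiver chain))

  chain-isForkAt : ∀ {p v} → ForkChain p v → IsForkAt p v
  chain-isForkAt (start t v _ hasIn hasOut e) =
    isForkAt-resp e (μ-acyclic-isForkAt (rot-isQuiver t) (rot-abundant t) (rot-acyclic t) hasIn hasOut)
  chain-isForkAt (extend u v chain v≢u e) =
    isForkAt-resp e (Fork.μ-isForkAt-off (chain-isQuiver chain) (chain-isForkAt chain) v≢u)

  Classified : Matrix k → Set
  Classified p = InOrbit p ⊎ ∃ (ForkChain p)

  classified-resp : ∀ {p p'} → Classified p → p ≐ p' → Classified p'
  classified-resp (inj₁ (t , t<k , e)) e' = inj₁ (t , t<k , ≐-trans (≐-sym e') e)
  classified-resp (inj₂ (v , chain)) e' = inj₂ (v , chain-resp chain e')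

  rot-suc-inOrbit : ∀ {t} → t ℕ.< k → InOrbit (rot (suc t))
  rot-suc-inOrbit {t} t<k with suc t ℕ.<? k
  ... | yes 1+t<k = suc t , 1+t<k , ≐-refl
  ... | no 1+t≮k with ℕP.≤-antisym t<k (ℕP.≮⇒≥ 1+t≮k)
  ...   | refl = 0 , s≤s z≤n , rot-k≐rot-0

  μ-rot-classified : ∀ t → t ℕ.< k → ∀ w → Classified (μ w (rot t))
  μ-rot-classified t t<k w with w ≟ source t t<k
  ... | yes refl = inj₁ (classified-orbit (rot-suc-inOrbit t<k))
    where
    classified-orbit : InOrbit (rot (suc t)) → InOrbit (μ w (rot t))
    classified-orbit (t' , t'<k , e) = t' , t'<k , ≐-trans (μ-source t t<k) e
  ... | no w≢s with w ≟ sink t t<k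
  ...   | yes refl = inj₁ (prev t , prev<k t<k , μ-sink t t<k)
  ...   | no w≢k = inj₂ (w , start t w t<k (source t t<k , s→w) (sink t t<k , w→k) ≐-refl)
    where
    s→w : + 0 < rot t (source t t<k) w
    s→w with abundant⇒oriented (rot-isQuiver t) (rot-abundant t) w≢s
    ... | inj₁ w→s = ⊥-elim (isSource t t<k w w→s)
    ... | inj₂ s→w = s→w
    w→k : + 0 < rot t w (sink t t<k)
    w→k with abundant⇒oriented (rot-isQuiver t) (rot-abundant t) w≢k
    ... | inj₁ w→k = w→k
    ... | inj₂ k→w = ⊥-elim (isSink t t<k w k→w)

  μ-undo : ∀ {p v} → ForkChain p v → Classified (μ v p)
  μ-undo (start t v t<k _ _ e) =
    inj₁ (t , t<k , ≐-trans (μ-cong v (≐-sym e)) (μ-involutive v (rot-isQuiver t)))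
  μ-undo (extend u v chain _ e) =
    inj₂ (u , chain-resp chain (≐-sym (≐-trans (μ-cong v (≐-sym e)) (μ-involutive v (chain-isQuiver chain)))))

  classified-μ : ∀ {p} w → Classified p → Classified (μ w p)
  classified-μ w (inj₁ (t , t<k , e)) = classified-resp (μ-rot-classified t t<k w) (μ-cong w (≐-sym e))
  classified-μ w (inj₂ (v , chain)) with w ≟ v
  ... | yes refl = μ-undo chain
  ... | no w≢v = inj₂ (w , extend v w chain w≢v ≐-refl)

  classified-mutateSeq : ∀ vs {p} → Classified p → Classified (mutateSeq vs p)
  classified-mutateSeq [] c = c
  classified-mutateSeq (v ∷ vs) c = classified-mutateSeq vs (classified-μ v c)

  inClass⇒classified : ∀ {p} → InClass A p → Classified p
  inClass⇒classified (vs , e) = classified-resp (classified-mutateSeq vs (inj₁ (0 , s≤s z≤n , A≐rot-0))) e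

  rot-inClass : ∀ t → t ℕ.< k → InClass A (rot t)
  rot-inClass zero _ = [] , A≐rot-0
  rot-inClass (suc t) 1+t<k = inClass-resp (μ-source t t<k) (inClass-μ (source t t<k) (rot-inClass t t<k))
    where
    t<k : t ℕ.< k
    t<k = ℕP.<-trans (ℕP.n<1+n t) 1+t<k

  -- The arrow between the sources of rot s and rot t is reversed exactly once on the way.
  rot-distinct : ∀ {s t} → s ℕ.< t → t ℕ.< k → ¬ (rot s ≐ rot t)
  rot-distinct {s} {t} s<t t<k same = abundant⇒≢0 sk ab a≢b (≡-neg⇒≡0 Aab≡-Aab)
    where
    s<k : s ℕ.< k
    s<k = ℕP.<-trans s<t t<k
    a b : Fin k
    a = source s s<k
    b = source t t<k
    a≢b : a ≢ b
    a≢b a≡b = ℕP.<-irrefl (trans (sym (rank-source s s<k)) (trans (cong rank a≡b) (rank-source t t<k))) s<t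
    Aab≡-Aab : A a b ≡ - A a b
    Aab≡-Aab with same a b
    ... | e rewrite mutated-false {s} {a} (ℕP.≤-reflexive (sym (rank-source s s<k)))
                  | mutated-true {t} {a} (subst (ℕ._< t) (sym (rank-source s s<k)) s<t)
                  | mutated-false {s} {b} (subst (s ℕ.≤_) (sym (rank-source t t<k)) (ℕP.<⇒≤ s<t))
                  | mutated-false {t} {b} (ℕP.≤-reflexive (sym (rank-source t t<k))) = e

  orbitAt : Fin k → Matrix k
  orbitAt i = rot (Fin.toℕ i)

  orbit : List (Matrix k)
  orbit = tabulate orbitAt

  orbitAt-inClass : ∀ i → InClass A (orbitAt i)
  orbitAt-inClass i = rot-inClass (Fin.toℕ i) (FinP.toℕ<n i)

  inOrbit⇒∈orbit : ∀ {p} → InOrbit p → Any (p ≐_) orbit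
  inOrbit⇒∈orbit {p} (t , t<k , e) = Any.tabulate⁺ {f = orbitAt} (Fin.fromℕ< t<k)
    (subst (λ t → p ≐ rot t) (sym (FinP.toℕ-fromℕ< t<k)) e)

  orbit-distinct : ∀ (i j : Fin k) → i ≢ j → ¬ (rot (Fin.toℕ i) ≐ rot (Fin.toℕ j))
  orbit-distinct i j i≢j e with ℕP.<-cmp (Fin.toℕ i) (Fin.toℕ j)
  ... | tri< i<j _ _ = rot-distinct i<j (FinP.toℕ<n j) e
  ... | tri≈ _ i≡j _ = i≢j (FinP.toℕ-injective i≡j)
  ... | tri> _ _ j<i = rot-distinct j<i (FinP.toℕ<n i) (≐-sym e)

  finiteForklessPart : FiniteForklessPart A
  finiteForklessPart = orbit , λ p p∈[A] ¬fork → forkless (inClass⇒classified p∈[A]) ¬fork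
    where
    forkless : ∀ {p} → Classified p → ¬ IsFork p → Any (p ≐_) orbit
    forkless (inj₁ inOrbit) _ = inOrbit⇒∈orbit inOrbit
    forkless (inj₂ (v , chain)) ¬fork = ⊥-elim (¬fork (v , chain-isForkAt chain))

  exactlyAbundantAcyclic : ExactlyAbundantAcyclic A k
  exactlyAbundantAcyclic =
    orbit ,
    List.length-tabulate orbitAt ,
    AllPairs.tabulate⁺ {f = orbitAt} (λ {i} {j} → orbit-distinct i j) ,
    All.tabulate⁺ {f = orbitAt} (λ i → orbitAt-inClass i , rot-abundant (Fin.toℕ i) , rot-acyclic (Fin.toℕ i)) ,
    λ p p∈[A] _ acyclic → onOrbit (inClass⇒classified p∈[A]) acyclic
    where
    onOrbit : ∀ {p} → Classified p → Acyclic p → Any (p ≐_) orbit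
    onOrbit (inj₁ inOrbit) _ = inOrbit⇒∈orbit inOrbit
    onOrbit (inj₂ (v , chain)) acyclic = ⊥-elim (proj₁ (proj₂ (chain-isForkAt chain)) acyclic)

module _ {n m : ℕ} {q : Matrix n} {e : Fin m → Fin n} where

  restrict-isQuiver : IsQuiver q → IsQuiver (restrict e q)
  restrict-isQuiver sk i j = sk (e i) (e j)

  restrict-abundant : Injective _≡_ _≡_ e → Abundant q → Abundant (restrict e q)
  restrict-abundant inj ab i j i≢j = ab (e i) (e j) (i≢j ∘ inj)

  restrict-acyclic : ∀ {U} → (∀ i → U (e i)) → AcyclicOn q U → Acyclic (restrict e q)
  restrict-acyclic {U} inU ac i p = ac (e i) (embed p)
    where
    embed : ∀ {a c} → PathIn (restrict e q) (λ _ → ⊤) a c → PathIn q U (e a) (e c)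
    embed (edge {a} {c} _ _ a→c) = edge (inU a) (inU c) a→c
    embed (step {a} _ a→b p) = step (inU a) a→b (embed p)

corollary3p4 : ∀ {n m : ℕ} (q : Matrix n) (r : Fin n) → IsQuiver q → IsForkAt q r
    → (e : Fin (suc m) → Fin n) → Injective _≡_ _≡_ e → (∀ (i : Fin (suc m)) → e i ≢ r)
    → FiniteForklessPart (restrict e q) × ExactlyAbundantAcyclic (restrict e q) (suc m)
corollary3p4 q r sk fk e inj e≢r =
  MutationClass.finiteForklessPart skQ' abQ' acQ' , MutationClass.exactlyAbundantAcyclic skQ' abQ' acQ'
  where
  skQ' : IsQuiver (restrict e q)
  skQ' = restrict-isQuiver sk
  abQ' : Abundant (restrict e q)
  abQ' = restrict-abundant {q = q} inj (Fork.abundant {f = q} sk fk)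
  acQ' : Acyclic (restrict e q)
  acQ' = restrict-acyclic e≢r (Fork.acyclicOff {f = q} sk fk)
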